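{- Let $\Gamma$ be an environment, $t$ a term of the simply typed $\lambda$-calculus and $A$ a simple type such that $\Gamma \vdash t : A$ is derivable. Then $\mathrm{ver}_A(t^{\Gamma}) \twoheadrightarrow \star$ in the metacalculus $\lambda^{\to}_{\mathfrak m}$.
   Context: Simple types: $A,B ::= \mathbf{a} \mid A \Rightarrow B$, where $\mathbf{a}$ ranges over a denumerable set of atomic types. Terms: $t ::= x \mid \lambda x.t \mid t\,s$. An environment $\Gamma$ is a finite set $\{x_1:A_1,\dots,x_n:A_n\}$ of assignments to distinct variables. Typing is given by the usual rules: $\Gamma, x:A \vdash x:A$; from $\Gamma,x:A \vdash t:B$ infer $\Gamma \vdash \lambda x.t : A \Rightarrow B$; from $\Gamma\vdash t:A\Rightarrow B$ and $\Gamma \vdash s:A$ infer $\Gamma\vdash t\,s:B$. The metacalculus $\lambda^{\to}_{\mathfrak m}$ has metaterms $M,N ::= x \mid \lambda x.M \mid M\,N \mid \star \mid (M \triangleright N) \mid \mathrm{gen}_{\mathbf{a}} \mid \mathrm{ver}_{\mathbf{a}}(M)$ for atomic types $\mathbf{a}$ (here $\star$ is a constant, "success", and $(M\triangleright N)$ is the guard). Terms of the simply typed $\lambda$-calculus are identified with metaterms built only from variables, abstractions and applications. For arbitrary types, generators and verifiers are defined by induction: $\mathrm{gen}_{A\Rightarrow B} := \lambda x.(\mathrm{ver}_A(x) \triangleright \mathrm{gen}_B)$ (with $x$ fresh) and $\mathrm{ver}_{A \Rightarrow B}(M) := \mathrm{ver}_B(M\,\mathrm{gen}_A)$. The reduction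 relation $\to$ is the closure under arbitrary contexts of the rules $(\lambda x.M)\,N \to M\{x:=N\}$ (capture-avoiding substitution), $(\star \triangleright M) \to M$, and $\mathrm{ver}_{\mathbf{a}}(\mathrm{gen}_{\mathbf{a}}) \to \star$; $\twoheadrightarrow$ is its reflexive-transitive closure. For an environment $\Gamma$, $M^{\Gamma}$ denotes the metaterm obtained from $M$ by replacing (capture-avoidingly) every free occurrence of each variable $x$ with $x:A \in \Gamma$ by $\mathrm{gen}_A$, leaving other variables unchanged. -}

module Defs where

open import Data.Nat using (ℕ; zero; suc; _∸_; _<ᵇ_)
open import Data.List using (List; []; _∷_; length)
open import Data.Bool using (if_then_else_)
open import Data.Maybe using (Maybe; just; nothing)
open import Relation.Binary.PropositionalEquality using (_≡_)
open import Relation.Binary.Construct.Closure.ReflexiveTransitive using (Star)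

data Ty : Set where
  atom : ℕ → Ty
  _⇒_  : Ty → Ty → Ty

infixr 7 _⇒_

data Term : Set where
  var : ℕ → Term
  lam : Term → Term
  app : Term → Term → Term

-- Environments: the type of the variable with de Bruijn index i is the
-- i-th entry.
Env : Set
Env = List Ty

lookupEnv : Env → ℕ → Maybe Ty
lookupEnv []      _       = nothing
lookupEnv (A ∷ Γ) zero    = just A
lookupEnv (A ∷ Γ) (suc i) = lookupEnv Γ i

data _⊢_∶_ (Γ : Env) : Term → Ty → Set where
  ⊢var : ∀ {i A} → lookupEnv Γ i ≡ just A → Γ ⊢ var i ∶ A
  ⊢lam : ∀ {t A B} → (A ∷ Γ) ⊢ t ∶ B → Γ ⊢ lam t ∶ (A ⇒ B)
  ⊢app : ∀ {t s A B} → Γ ⊢ t ∶ (A ⇒ B) → Γ ⊢ s ∶ A → Γ ⊢ app t s ∶ B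

data Meta : Set where
  mvar  : ℕ → Meta
  mlam  : Meta → Meta
  mapp  : Meta → Meta → Meta
  ⋆     : Meta
  _▷_   : Meta → Meta → Meta
  gena  : ℕ → Meta
  vera  : ℕ → Meta → Meta

⌜_⌝ : Term → Meta
⌜ var i ⌝   = mvar i
⌜ lam t ⌝   = mlam ⌜ t ⌝
⌜ app t s ⌝ = mapp ⌜ t ⌝ ⌜ s ⌝

ext : (ℕ → ℕ) → ℕ → ℕ
ext ρ zero    = zero
ext ρ (suc i) = suc (ρ i)

rename : (ℕ → ℕ) → Meta → Meta
rename ρ (mvar i)   = mvar (ρ i)
rename ρ (mlam M)   = mlam (rename (ext ρ) M)
rename ρ (mapp M N) = mapp (rename ρ M) (rename ρ N)
rename ρ ⋆          = ⋆
rename ρ (M ▷ N)    = rename ρ M ▷ rename ρ N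
rename ρ (gena a)   = gena a
rename ρ (vera a M) = vera a (rename ρ M)

exts : (ℕ → Meta) → ℕ → Meta
exts σ zero    = mvar zero
exts σ (suc i) = rename suc (σ i)

subst : (ℕ → Meta) → Meta → Meta
subst σ (mvar i)   = σ i
subst σ (mlam M)   = mlam (subst (exts σ) M)
subst σ (mapp M N) = mapp (subst σ M) (subst σ N)
subst σ ⋆          = ⋆
subst σ (M ▷ N)    = subst σ M ▷ subst σ N
subst σ (gena a)   = gena a
subst σ (vera a M) = vera a (subst σ M)

subst₀ : Meta → Meta → Meta
subst₀ M N = subst σ M
  where
  σ : ℕ → Meta
  σ zero    = N
  σ (suc i) = mvar i

-- Generators and verifiers at arbitrary types.
-- gen_{A⇒B} = λx.(ver_A(x) ▷ gen_B),  ver_{A⇒B}(M) = ver_B(M gen_A).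
-- (gen_B is closed, so no shifting is needed under the binder.)
gen : Ty → Meta
ver : Ty → Meta → Meta
gen (atom a)  = gena a
gen (A ⇒ B)   = mlam (ver A (mvar zero) ▷ gen B)
ver (atom a) M = vera a M
ver (A ⇒ B)  M = ver B (mapp M (gen A))

data _⟶_ : Meta → Meta → Set where
  β      : ∀ {M N} → mapp (mlam M) N ⟶ subst₀ M N
  guard⋆ : ∀ {M} → (⋆ ▷ M) ⟶ M
  vergen : ∀ {a} → vera a (gena a) ⟶ ⋆
  ξlam   : ∀ {M M'} → M ⟶ M' → mlam M ⟶ mlam M'
  ξappₗ  : ∀ {M M' N} → M ⟶ M' → mapp M N ⟶ mapp M' N
  ξappᵣ  : ∀ {M N N'} → N ⟶ N' → mapp M N ⟶ mapp M N'
  ξ▷ₗ    : ∀ {M M' N} → M ⟶ M' → (M ▷ N) ⟶ (M' ▷ N)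
  ξ▷ᵣ    : ∀ {M N N'} → N ⟶ N' → (M ▷ N) ⟶ (M ▷ N')
  ξver   : ∀ {a M M'} → M ⟶ M' → vera a M ⟶ vera a M'

_↠_ : Meta → Meta → Set
_↠_ = Star _⟶_

-- M^Γ: replace every free variable declared in Γ by gen of its type.
-- At binder depth d, index i < d is bound; index d + j with j < |Γ| is
-- the j-th variable of Γ and becomes gen (Γ[j]) (closed, so no shifting);
-- other free variables are left unchanged (re-indexed past Γ).
instVar : Env → ℕ → ℕ → Meta
instVar Γ zero i with lookupEnv Γ i
... | just A  = gen A
... | nothing = mvar (i ∸ length Γ)
instVar Γ (suc d) zero    = mvar zero
instVar Γ (suc d) (suc i) = rename suc (instVar Γ d i)

inst : Env → ℕ → Meta → Meta
inst Γ d (mvar i)   = instVar Γ d i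
inst Γ d (mlam M)   = mlam (inst Γ (suc d) M)
inst Γ d (mapp M N) = mapp (inst Γ d M) (inst Γ d N)
inst Γ d ⋆          = ⋆
inst Γ d (M ▷ N)    = inst Γ d M ▷ inst Γ d N
inst Γ d (gena a)   = gena a
inst Γ d (vera a M) = vera a (inst Γ d M)

_^_ : Meta → Env → Meta
M ^ Γ = inst Γ zero M

-- Tait-style reducibility. A metaterm is reducible at an atom a when its
-- verifier reduces to ⋆, and at A ⇒ B when it maps reducible arguments to
-- reducible results. By simultaneous induction on types, every reducible M
-- passes its verifier, and every generator gen A is reducible (gen_{A⇒B} N
-- first runs ver_A N, which succeeds, and then behaves as gen_B). The
-- fundamental lemma makes any substitution instance of a typed term by
-- reducible metaterms reducible; t^Γ is the instance substituting generators.
module Submission where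

open import Defs
open import Data.Nat using (ℕ; zero; suc)
open import Data.Maybe using (just)
open import Data.List using (_∷_)
open import Relation.Binary.PropositionalEquality
  using (_≡_; refl; sym; trans; cong; cong₂; module ≡-Reasoning) renaming (subst to subst-≡)
open import Relation.Binary.Construct.Closure.ReflexiveTransitive
  using (ε; _◅_; _◅◅_; gmap)

_∷ₛ_ : Meta → (ℕ → Meta) → ℕ → Meta
(N ∷ₛ σ) zero    = N
(N ∷ₛ σ) (suc i) = σ i

rename-cong : ∀ {ρ ρ'} → (∀ i → ρ i ≡ ρ' i) → ∀ M → rename ρ M ≡ rename ρ' M
rename-cong h (mvar i)   = cong mvar (h i)
rename-cong h (mlam M)   = cong mlam (rename-cong ext-cong M)
  where ext-cong : ∀ i → ext _ i ≡ ext _ i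
        ext-cong zero    = refl
        ext-cong (suc i) = cong suc (h i)
rename-cong h (mapp M N) = cong₂ mapp (rename-cong h M) (rename-cong h N)
rename-cong h ⋆          = refl
rename-cong h (M ▷ N)    = cong₂ _▷_ (rename-cong h M) (rename-cong h N)
rename-cong h (gena a)   = refl
rename-cong h (vera a M) = cong (vera a) (rename-cong h M)

subst-cong : ∀ {σ σ'} → (∀ i → σ i ≡ σ' i) → ∀ M → subst σ M ≡ subst σ' M
subst-cong h (mvar i)   = h i
subst-cong h (mlam M)   = cong mlam (subst-cong exts-cong M)
  where exts-cong : ∀ i → exts _ i ≡ exts _ i
        exts-cong zero    = refl
        exts-cong (suc i) = cong (rename suc) (h i)
subst-cong h (mapp M N) = cong₂ mapp (subst-cong h M) (subst-cong h N)
subst-cong h ⋆          = refl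
subst-cong h (M ▷ N)    = cong₂ _▷_ (subst-cong h M) (subst-cong h N)
subst-cong h (gena a)   = refl
subst-cong h (vera a M) = cong (vera a) (subst-cong h M)

rename-rename : ∀ ρ ρ' M → rename ρ (rename ρ' M) ≡ rename (λ i → ρ (ρ' i)) M
rename-rename ρ ρ' (mvar i)   = refl
rename-rename ρ ρ' (mlam M)   =
  cong mlam (trans (rename-rename (ext ρ) (ext ρ') M) (rename-cong ext-∘ M))
  where ext-∘ : ∀ i → ext ρ (ext ρ' i) ≡ ext (λ j → ρ (ρ' j)) i
        ext-∘ zero    = refl
        ext-∘ (suc i) = refl
rename-rename ρ ρ' (mapp M N) = cong₂ mapp (rename-rename ρ ρ' M) (rename-rename ρ ρ' N)
rename-rename ρ ρ' ⋆          = refl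
rename-rename ρ ρ' (M ▷ N)    = cong₂ _▷_ (rename-rename ρ ρ' M) (rename-rename ρ ρ' N)
rename-rename ρ ρ' (gena a)   = refl
rename-rename ρ ρ' (vera a M) = cong (vera a) (rename-rename ρ ρ' M)

subst-rename : ∀ τ ρ M → subst τ (rename ρ M) ≡ subst (λ i → τ (ρ i)) M
subst-rename τ ρ (mvar i)   = refl
subst-rename τ ρ (mlam M)   =
  cong mlam (trans (subst-rename (exts τ) (ext ρ) M) (subst-cong exts-ext M))
  where exts-ext : ∀ i → exts τ (ext ρ i) ≡ exts (λ j → τ (ρ j)) i
        exts-ext zero    = refl
        exts-ext (suc i) = refl
subst-rename τ ρ (mapp M N) = cong₂ mapp (subst-rename τ ρ M) (subst-rename τ ρ N)
subst-rename τ ρ ⋆          = refl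
subst-rename τ ρ (M ▷ N)    = cong₂ _▷_ (subst-rename τ ρ M) (subst-rename τ ρ N)
subst-rename τ ρ (gena a)   = refl
subst-rename τ ρ (vera a M) = cong (vera a) (subst-rename τ ρ M)

rename-subst : ∀ ρ σ M → rename ρ (subst σ M) ≡ subst (λ i → rename ρ (σ i)) M
rename-subst ρ σ (mvar i)   = refl
rename-subst ρ σ (mlam M)   =
  cong mlam (trans (rename-subst (ext ρ) (exts σ) M) (subst-cong ext-exts M))
  where ext-exts : ∀ i → rename (ext ρ) (exts σ i) ≡ exts (λ j → rename ρ (σ j)) i
        ext-exts zero    = refl
        ext-exts (suc i) = trans (rename-rename (ext ρ) suc (σ i))
                                 (sym (rename-rename suc ρ (σ i)))
rename-subst ρ σ (mapp M N) = cong₂ mapp (rename-subst ρ σ M) (rename-subst ρ σ N)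
rename-subst ρ σ ⋆          = refl
rename-subst ρ σ (M ▷ N)    = cong₂ _▷_ (rename-subst ρ σ M) (rename-subst ρ σ N)
rename-subst ρ σ (gena a)   = refl
rename-subst ρ σ (vera a M) = cong (vera a) (rename-subst ρ σ M)

subst-subst : ∀ τ σ M → subst τ (subst σ M) ≡ subst (λ i → subst τ (σ i)) M
subst-subst τ σ (mvar i)   = refl
subst-subst τ σ (mlam M)   =
  cong mlam (trans (subst-subst (exts τ) (exts σ) M) (subst-cong exts-exts M))
  where exts-exts : ∀ i → subst (exts τ) (exts σ i) ≡ exts (λ j → subst τ (σ j)) i
        exts-exts zero    = refl
        exts-exts (suc i) = trans (subst-rename (exts τ) suc (σ i))
                                  (sym (rename-subst suc τ (σ i)))
subst-subst τ σ (mapp M N) = cong₂ mapp (subst-subst τ σ M) (subst-subst τ σ N)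
subst-subst τ σ ⋆          = refl
subst-subst τ σ (M ▷ N)    = cong₂ _▷_ (subst-subst τ σ M) (subst-subst τ σ N)
subst-subst τ σ (gena a)   = refl
subst-subst τ σ (vera a M) = cong (vera a) (subst-subst τ σ M)

subst-id : ∀ M → subst mvar M ≡ M
subst-id (mvar i)   = refl
subst-id (mlam M)   = cong mlam (trans (subst-cong exts-id M) (subst-id M))
  where exts-id : ∀ i → exts mvar i ≡ mvar i
        exts-id zero    = refl
        exts-id (suc i) = refl
subst-id (mapp M N) = cong₂ mapp (subst-id M) (subst-id N)
subst-id ⋆          = refl
subst-id (M ▷ N)    = cong₂ _▷_ (subst-id M) (subst-id N)
subst-id (gena a)   = refl
subst-id (vera a M) = cong (vera a) (subst-id M)

subst₀≡subst-∷ₛ : ∀ M N → subst₀ M N ≡ subst (N ∷ₛ mvar) M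
subst₀≡subst-∷ₛ M N = subst-cong (λ { zero → refl ; (suc i) → refl }) M

subst₀-exts : ∀ σ M N → subst₀ (subst (exts σ) M) N ≡ subst (N ∷ₛ σ) M
subst₀-exts σ M N = begin
  subst₀ (subst (exts σ) M) N                            ≡⟨ subst₀≡subst-∷ₛ (subst (exts σ) M) N ⟩
  subst (N ∷ₛ mvar) (subst (exts σ) M)                   ≡⟨ subst-subst (N ∷ₛ mvar) (exts σ) M ⟩
  subst (λ i → subst (N ∷ₛ mvar) (exts σ i)) M           ≡⟨ subst-cong exts-∷ₛ M ⟩
  subst (N ∷ₛ σ) M                                       ∎
  where
  open ≡-Reasoning
  exts-∷ₛ : ∀ i → subst (N ∷ₛ mvar) (exts σ i) ≡ (N ∷ₛ σ) i
  exts-∷ₛ zero    = refl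
  exts-∷ₛ (suc i) = trans (subst-rename (N ∷ₛ mvar) suc (σ i)) (subst-id (σ i))

subst-gen : ∀ σ A → subst σ (gen A) ≡ gen A
subst-ver : ∀ σ A M → subst σ (ver A M) ≡ ver A (subst σ M)
subst-gen σ (atom a) = refl
subst-gen σ (A ⇒ B)  =
  cong mlam (cong₂ _▷_ (subst-ver (exts σ) A (mvar zero)) (subst-gen (exts σ) B))
subst-ver σ (atom a) M = refl
subst-ver σ (A ⇒ B)  M =
  trans (subst-ver σ B (mapp M (gen A)))
        (cong (λ X → ver B (mapp (subst σ M) X)) (subst-gen σ A))

inst≡subst : ∀ Γ d M → inst Γ d M ≡ subst (instVar Γ d) M
inst≡subst Γ d (mvar i)   = refl
inst≡subst Γ d (mlam M)   = cong mlam (trans (inst≡subst Γ (suc d) M) (subst-cong instVar-suc M))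
  where instVar-suc : ∀ i → instVar Γ (suc d) i ≡ exts (instVar Γ d) i
        instVar-suc zero    = refl
        instVar-suc (suc i) = refl
inst≡subst Γ d (mapp M N) = cong₂ mapp (inst≡subst Γ d M) (inst≡subst Γ d N)
inst≡subst Γ d ⋆          = refl
inst≡subst Γ d (M ▷ N)    = cong₂ _▷_ (inst≡subst Γ d M) (inst≡subst Γ d N)
inst≡subst Γ d (gena a)   = refl
inst≡subst Γ d (vera a M) = cong (vera a) (inst≡subst Γ d M)

instVar-lookup : ∀ Γ i {A} → lookupEnv Γ i ≡ just A → instVar Γ zero i ≡ gen A
instVar-lookup Γ i e with lookupEnv Γ i
instVar-lookup Γ i refl | just _ = refl

β-≡ : ∀ {M N M'} → subst₀ M N ≡ M' → mapp (mlam M) N ↠ M'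
β-≡ refl = β ◅ ε

↠-appₗ : ∀ {M M'} N → M ↠ M' → mapp M N ↠ mapp M' N
↠-appₗ N = gmap (λ X → mapp X N) ξappₗ

↠-▷ₗ : ∀ {M M'} N → M ↠ M' → (M ▷ N) ↠ (M' ▷ N)
↠-▷ₗ N = gmap (λ X → X ▷ N) ξ▷ₗ

↠-vera : ∀ a {M M'} → M ↠ M' → vera a M ↠ vera a M'
↠-vera a = gmap (vera a) ξver

gen⇒-app : ∀ A B N → mapp (gen (A ⇒ B)) N ↠ (ver A N ▷ gen B)
gen⇒-app A B N =
  β-≡ (trans (subst₀≡subst-∷ₛ (ver A (mvar zero) ▷ gen B) N)
             (cong₂ _▷_ (subst-ver (N ∷ₛ mvar) A (mvar zero)) (subst-gen (N ∷ₛ mvar) B)))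

Red : Ty → Meta → Set
Red (atom a) M = vera a M ↠ ⋆
Red (A ⇒ B)  M = ∀ N → Red A N → Red B (mapp M N)

red-expand : ∀ A {M M'} → M ↠ M' → Red A M' → Red A M
red-expand (atom a) M↠M' r      = ↠-vera a M↠M' ◅◅ r
red-expand (A ⇒ B)  M↠M' r N rN = red-expand B (↠-appₗ N M↠M') (r N rN)

red⇒ver : ∀ A {M} → Red A M → ver A M ↠ ⋆
red-gen : ∀ A → Red A (gen A)
red⇒ver (atom a) r = r
red⇒ver (A ⇒ B)  r = red⇒ver B (r (gen A) (red-gen A))
red-gen (atom a)     = vergen ◅ ε
red-gen (A ⇒ B) N rN =
  red-expand B (gen⇒-app A B N ◅◅ ↠-▷ₗ (gen B) (red⇒ver A rN) ◅◅ guard⋆ ◅ ε) (red-gen B)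

RedSubst : Env → (ℕ → Meta) → Set
RedSubst Δ σ = ∀ i {B} → lookupEnv Δ i ≡ just B → Red B (σ i)

redSubst-∷ₛ : ∀ {Δ σ A N} → Red A N → RedSubst Δ σ → RedSubst (A ∷ Δ) (N ∷ₛ σ)
redSubst-∷ₛ rN rσ zero    refl = rN
redSubst-∷ₛ rN rσ (suc i) e    = rσ i e

fundamental : ∀ {Δ t A} → Δ ⊢ t ∶ A → ∀ σ → RedSubst Δ σ → Red A (subst σ ⌜ t ⌝)
fundamental (⊢var e)      σ rσ = rσ _ e
fundamental (⊢app d e)    σ rσ = fundamental d σ rσ _ (fundamental e σ rσ)
fundamental (⊢lam {t} d)  σ rσ N rN =
  red-expand _ (β-≡ (subst₀-exts σ ⌜ t ⌝ N)) (fundamental d (N ∷ₛ σ) (redSubst-∷ₛ rN rσ))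

redSubst-gen : ∀ Γ → RedSubst Γ (instVar Γ zero)
redSubst-gen Γ i {B} e = subst-≡ (Red B) (sym (instVar-lookup Γ i e)) (red-gen B)

theorem3p11 : (Γ : Env) (t : Term) (A : Ty) → Γ ⊢ t ∶ A → ver A (⌜ t ⌝ ^ Γ) ↠ ⋆
theorem3p11 Γ t A d = red⇒ver A red-inst
  where
  red-inst : Red A (⌜ t ⌝ ^ Γ)
  red-inst = subst-≡ (Red A) (sym (inst≡subst Γ zero ⌜ t ⌝))
                     (fundamental d (instVar Γ zero) (redSubst-gen Γ))
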